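{- Let $S_{2/9} = \{(0,0),(1,0)\} + 3\mathbb{Z}^2$. Then $S_{2/9}$ is BI-stable and $\overline{\delta}(S_{2/9}) = 2/9$.
   Context: A lattice triangle is the convex hull in $\mathbb{R}^2$ of three non-collinear points of $\mathbb{Z}^2$. A triangle is a set $T = \Delta \cap \mathbb{Z}^2$ for a lattice triangle $\Delta$. A triangle is minimal if it contains exactly $4$ points of $\mathbb{Z}^2$; a minimal triangle is a border triangle if its non-vertex point lies on the boundary of $\Delta$, and an internal triangle if that point lies in the interior of $\Delta$. A set $S \subseteq \mathbb{Z}^2$ is BI-stable if no border triangle and no internal triangle has exactly three of its points in $S$. For integers $a\le b$, $[a,b]=\{i\in\mathbb{Z}: a\le i\le b\}$. The upper density of $X\subseteq\mathbb{Z}^2$ is $\overline{\delta}(X)=\limsup_{n\to\infty}|X\cap[-n,n]^2|/|[-n,n]^2|$. -}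

module Defs where

open import Data.Nat as ℕ using (ℕ; suc)
open import Data.Integer as ℤ using (ℤ; +_; _-_; _*_; _≤_; _<_; -_)
open import Data.Rational as ℚ using (ℚ; _/_; 0ℚ)
open import Data.Product using (Σ; _×_; _,_)
open import Data.Sum using (_⊎_)
open import Data.List using (List; length)
open import Data.List.Membership.Propositional using (_∈_)
open import Data.List.Relation.Unary.Unique.Propositional using (Unique)
open import Relation.Nullary using (¬_)
open import Relation.Binary.PropositionalEquality using (_≡_; _≢_)

Pt : Set
Pt = ℤ × ℤ

orient : Pt → Pt → Pt → ℤ
orient (ax , ay) (bx , by) (px , py) = (bx - ax) * (py - ay) - (by - ay) * (px - ax)

NonCollinear : Pt → Pt → Pt → Set
NonCollinear a b c = orient a b c ≢ + 0

InTri : Pt → Pt → Pt → Pt → Set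
InTri a b c p =
  (+ 0 ≤ orient a b p × + 0 ≤ orient b c p × + 0 ≤ orient c a p)
  ⊎ (orient a b p ≤ + 0 × orient b c p ≤ + 0 × orient c a p ≤ + 0)

InInterior : Pt → Pt → Pt → Pt → Set
InInterior a b c p =
  (+ 0 < orient a b p × + 0 < orient b c p × + 0 < orient c a p)
  ⊎ (orient a b p < + 0 × orient b c p < + 0 × orient c a p < + 0)

MinimalTri : Pt → Pt → Pt → Pt → Set
MinimalTri a b c d =
  NonCollinear a b c × d ≢ a × d ≢ b × d ≢ c × InTri a b c d
  × (∀ p → InTri a b c p → p ≡ a ⊎ p ≡ b ⊎ p ≡ c ⊎ p ≡ d)

BorderTri : Pt → Pt → Pt → Pt → Set
BorderTri a b c d = MinimalTri a b c d × ¬ InInterior a b c d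

InternalTri : Pt → Pt → Pt → Pt → Set
InternalTri a b c d = MinimalTri a b c d × InInterior a b c d

ExactlyThree : (Pt → Set) → Pt → Pt → Pt → Pt → Set
ExactlyThree S a b c d =
    (¬ S a × S b × S c × S d)
  ⊎ (S a × ¬ S b × S c × S d)
  ⊎ (S a × S b × ¬ S c × S d)
  ⊎ (S a × S b × S c × ¬ S d)

BIStable : (Pt → Set) → Set
BIStable S =
  (∀ a b c d → BorderTri a b c d → ¬ ExactlyThree S a b c d)
  × (∀ a b c d → InternalTri a b c d → ¬ ExactlyThree S a b c d)

S29 : Pt → Set
S29 (x , y) = Σ ℤ λ i → Σ ℤ λ j →
  ((x ≡ + 3 * i) ⊎ (x ≡ + 3 * i ℤ.+ + 1)) × y ≡ + 3 * j

InBox : ℕ → Pt → Set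
InBox n (x , y) = (- (+ n) ≤ x × x ≤ + n) × (- (+ n) ≤ y × y ≤ + n)

CountIs : (Pt → Set) → ℕ → ℕ → Set
CountIs X n N = Σ (List Pt) λ L → Unique L × length L ≡ N
  × (∀ p → (p ∈ L → InBox n p × X p) × (InBox n p × X p → p ∈ L))

-- N / |[-n,n]²| = N / (2n+1)²,  with (2n+1)² = suc (4n² + 4n)
ratio : ℕ → ℕ → ℚ
ratio n N = + N / suc (4 ℕ.* n ℕ.* n ℕ.+ 4 ℕ.* n)

-- limsup_{n→∞} |X ∩ [-n,n]²| / |[-n,n]²| = L  (ε-characterisation of limsup)
UpperDensityIs : (Pt → Set) → ℚ → Set
UpperDensityIs X L =
  (∀ ε → 0ℚ ℚ.< ε → Σ ℕ λ n₀ → ∀ n → n₀ ℕ.≤ n → ∀ N → CountIs X n N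
      → ratio n N ℚ.< L ℚ.+ ε)
  × (∀ ε → 0ℚ ℚ.< ε → ∀ n₀ → Σ ℕ λ n → n₀ ℕ.≤ n × Σ ℕ λ N → CountIs X n N
      × L ℚ.- ε ℚ.< ratio n N)

module Submission where

-- A minimal triangle has only four lattice points, so it cannot contain two points x and x + 3u with
-- u ≠ 0: by convexity it would then also contain x + u and x + 2u, and these four collinear points
-- would exhaust its lattice points, making the triangle degenerate. Among any three points of S₂/₉
-- two lie in the same class (0,0) + 3ℤ² or (1,0) + 3ℤ², i.e. differ by 3u with u ≠ 0, so no minimal
-- triangle meets S₂/₉ in exactly three points. For the density, the box of radius 3k + 1 has side
-- 3(2k + 1) and contains exactly 2(2k + 1)² points of S₂/₉, so the ratio is exactly 2/9 along these
-- radii, while every box of radius n lies in such a box with 3k ≤ n + 2, whose excess is O(1/n).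

open import Defs
open import Data.Product using (_×_)
open import Data.Integer using (+_)
open import Data.Rational using (_/_)

open import Data.Bool using (Bool; true; false)
open import Data.Nat as ℕ using (ℕ; suc; z≤n; s≤s)
import Data.Nat.Properties as ℕ
open import Data.Integer as ℤ using (ℤ; -[1+_]; +[1+_]; 0ℤ; -1ℤ; +≤+; -<-)
import Data.Integer.Properties as ℤ
open import Data.Product using (Σ; ∃-syntax; _,_; proj₁; proj₂)
open import Data.Product.Properties using (≡-dec)
open import Data.Sum using (_⊎_; inj₁; inj₂)
open import Data.Empty using (⊥; ⊥-elim)
open import Data.List using (List; []; _∷_; _++_; map; length; filter; applyUpTo; cartesianProductWith; cartesianProduct)
open import Data.List.Properties using (filter-notAll; length-applyUpTo; length-++; length-map)
open import Data.List.Membership.Propositional using (_∈_; _∉_)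
open import Data.List.Membership.Propositional.Properties
  using (∈-filter⁺; ∈-applyUpTo⁺; ∈-applyUpTo⁻; ∈-cartesianProductWith⁺; ∈-cartesianProductWith⁻; ∈-cartesianProduct⁺; ∈-cartesianProduct⁻)
open import Data.List.Membership.DecPropositional using () renaming (_∈?_ to ∈?)
open import Data.List.Relation.Binary.Subset.Propositional using (_⊆_)
open import Data.List.Relation.Unary.Any as Any using (here; there)
import Data.List.Relation.Unary.All as All
open import Data.List.Relation.Unary.AllPairs using ([]; _∷_)
open import Data.List.Relation.Unary.Unique.Propositional using (Unique)
open import Data.List.Relation.Unary.Unique.Propositional.Properties using (applyUpTo⁺₁; cartesianProductWith⁺; cartesianProduct⁺)
open import Function using (_∘_)
open import Relation.Nullary using (¬_; yes; no; ¬?)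
open import Relation.Binary.Definitions using (DecidableEquality)
open import Relation.Binary.PropositionalEquality
  using (_≡_; _≢_; ≢-sym; refl; sym; trans; cong; cong₂; subst; subst₂; module ≡-Reasoning)

length-cartesianProductWith : ∀ {A B C : Set} (f : A → B → C) xs ys →
                              length (cartesianProductWith f xs ys) ≡ length xs ℕ.* length ys
length-cartesianProductWith f [] ys = refl
length-cartesianProductWith f (x ∷ xs) ys = begin
  length (map (f x) ys ++ cartesianProductWith f xs ys)   ≡⟨ length-++ (map (f x) ys) ⟩
  length (map (f x) ys) ℕ.+ length (cartesianProductWith f xs ys)
    ≡⟨ cong₂ ℕ._+_ (length-map (f x) ys) (length-cartesianProductWith f xs ys) ⟩
  length ys ℕ.+ length xs ℕ.* length ys                   ∎
  where open ≡-Reasoning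

module _ {A : Set} (_≟_ : DecidableEquality A) where

  private
    _≢?_ : (y x : A) → _
    y ≢? x = ¬? (y ≟ x)

  ⊆-filter-≢ : ∀ {y xs ys} → y ∉ xs → xs ⊆ ys → xs ⊆ filter (y ≢?_) ys
  ⊆-filter-≢ y∉xs xs⊆ys x∈xs = ∈-filter⁺ (_ ≢?_) (xs⊆ys x∈xs) λ { refl → y∉xs x∈xs }

  length-filter-≢-< : ∀ {y ys} → y ∈ ys → length (filter (y ≢?_) ys) ℕ.< length ys
  length-filter-≢-< y∈ys = filter-notAll (_ ≢?_) _ (Any.map (λ { refl y≢y → y≢y refl }) y∈ys)

  Unique-⊆⇒length-≤ : ∀ {xs ys} → Unique xs → xs ⊆ ys → length xs ℕ.≤ length ys
  Unique-⊆⇒length-≤ {[]} _ _ = z≤n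
  Unique-⊆⇒length-≤ {x ∷ xs} (x∉xs ∷ unique) x∷xs⊆ys = ℕ.≤-trans
    (s≤s (Unique-⊆⇒length-≤ unique (⊆-filter-≢ (λ x∈xs → All.lookup x∉xs x∈xs refl) (x∷xs⊆ys ∘ there))))
    (length-filter-≢-< (x∷xs⊆ys (here refl)))

  Unique-⊆-length-≥⇒⊇ : ∀ {xs ys} → Unique xs → xs ⊆ ys → length ys ℕ.≤ length xs → ys ⊆ xs
  Unique-⊆-length-≥⇒⊇ {xs} unique xs⊆ys ys≤xs {y} y∈ys with ∈? _≟_ y xs
  ... | yes y∈xs = y∈xs
  ... | no  y∉xs = ⊥-elim (ℕ.<-irrefl refl (ℕ.<-≤-trans
          (ℕ.≤-<-trans (Unique-⊆⇒length-≤ unique (⊆-filter-≢ y∉xs xs⊆ys)) (length-filter-≢-< y∈ys)) ys≤xs))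

module _ where

  open import Data.Integer using (_+_; _-_; _*_; -_; _≤_)
  open import Data.Integer.Tactic.RingSolver using (solve-∀)
  open import Algebra.Properties.AbelianGroup ℤ.+-0-abelianGroup using (∙-cancelˡ; ∙-cancelʳ)

  -- Orientation and convexity

  infixl 6 _+ᵥ_ _-ᵥ_
  infixl 7 _*ᵥ_

  _+ᵥ_ : Pt → Pt → Pt
  (x , y) +ᵥ (u , v) = x + u , y + v

  _-ᵥ_ : Pt → Pt → Pt
  (x , y) -ᵥ (u , v) = x - u , y - v

  _*ᵥ_ : ℤ → Pt → Pt
  k *ᵥ (u , v) = k * u , k * v

  det : Pt → Pt → ℤ
  det (x , y) (u , v) = x * v - y * u

  _≟ₚ_ : DecidableEquality Pt
  _≟ₚ_ = ≡-dec ℤ._≟_ ℤ._≟_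

  orient-along : ∀ a b p u k → orient a b (p +ᵥ k *ᵥ u) ≡ orient a b p + k * det (b -ᵥ a) u
  orient-along (ax , ay) (bx , by) (px , py) (ux , uy) k = identity ax ay bx by px py ux uy k
    where
    identity : ∀ ax ay bx by px py ux uy k →
      (bx - ax) * ((py + k * uy) - ay) - (by - ay) * ((px + k * ux) - ax)
      ≡ ((bx - ax) * (py - ay) - (by - ay) * (px - ax)) + k * ((bx - ax) * uy - (by - ay) * ux)
    identity = solve-∀

  orient-collinear : ∀ p u k l m → orient (p +ᵥ k *ᵥ u) (p +ᵥ l *ᵥ u) (p +ᵥ m *ᵥ u) ≡ 0ℤ
  orient-collinear (px , py) (ux , uy) k l m = identity px py ux uy k l m
    where
    identity : ∀ px py ux uy k l m →
      ((px + l * ux) - (px + k * ux)) * ((py + m * uy) - (py + k * uy))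
      - ((py + l * uy) - (py + k * uy)) * ((px + m * ux) - (px + k * ux)) ≡ 0ℤ
    identity = solve-∀

  orient-sum : ∀ a b c p → orient a b p + orient b c p + orient c a p ≡ orient a b c
  orient-sum (ax , ay) (bx , by) (cx , cy) (px , py) = identity ax ay bx by cx cy px py
    where
    identity : ∀ ax ay bx by cx cy px py →
      ((bx - ax) * (py - ay) - (by - ay) * (px - ax)) + ((cx - bx) * (py - by) - (cy - by) * (px - bx))
      + ((ax - cx) * (py - cy) - (ay - cy) * (px - cx))
      ≡ (bx - ax) * (cy - ay) - (by - ay) * (cx - ax)
    identity = solve-∀

  orient-rotate : ∀ a b c → orient b c a ≡ orient a b c
  orient-rotate (ax , ay) (bx , by) (cx , cy) = identity ax ay bx by cx cy
    where
    identity : ∀ ax ay bx by cx cy →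
      (cx - bx) * (ay - by) - (cy - by) * (ax - bx) ≡ (bx - ax) * (cy - ay) - (by - ay) * (cx - ax)
    identity = solve-∀

  orient-head : ∀ a b → orient a b b ≡ 0ℤ
  orient-head (ax , ay) (bx , by) = identity ax ay bx by
    where
    identity : ∀ ax ay bx by → (bx - ax) * (by - ay) - (by - ay) * (bx - ax) ≡ 0ℤ
    identity = solve-∀

  orient-base : ∀ a c → orient a a c ≡ 0ℤ
  orient-base a c = trans (orient-rotate c a a) (orient-head c a)

  orient-tail : ∀ a b → orient a b a ≡ 0ℤ
  orient-tail a b = trans (orient-rotate a a b) (orient-base a b)

  scaled-nonneg : ∀ m {x} → 0ℤ ≤ x → 0ℤ ≤ + m * x
  scaled-nonneg m {x} 0≤x = subst (_≤ + m * x) (ℤ.*-zeroʳ (+ m)) (ℤ.*-monoˡ-≤-nonNeg (+ m) 0≤x)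

  convex-split : ∀ α β k l →
    + suc (k ℕ.+ l) * (α + + k * β) ≡ + suc l * α + + k * (α + + suc (k ℕ.+ l) * β)
  convex-split α β k l rewrite ℤ.pos-+ 1 (k ℕ.+ l) | ℤ.pos-+ 1 l | ℤ.pos-+ k l = identity α β (+ k) (+ l)
    where
    identity : ∀ α β k l → (+ 1 + (k + l)) * (α + k * β) ≡ (+ 1 + l) * α + k * (α + (+ 1 + (k + l)) * β)
    identity = solve-∀

  affine-nonneg-between : ∀ {α β} k l → 0ℤ ≤ α → 0ℤ ≤ α + + suc (k ℕ.+ l) * β → 0ℤ ≤ α + + k * β
  affine-nonneg-between {α} {β} k l 0≤α 0≤αₙ =
    ℤ.*-cancelˡ-≤-pos 0ℤ (α + + k * β) (+ suc (k ℕ.+ l)) (begin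
      + suc (k ℕ.+ l) * 0ℤ                             ≡⟨ ℤ.*-zeroʳ (+ suc (k ℕ.+ l)) ⟩
      0ℤ                                               ≤⟨ ℤ.+-mono-≤ (scaled-nonneg (suc l) 0≤α) (scaled-nonneg k 0≤αₙ) ⟩
      + suc l * α + + k * (α + + suc (k ℕ.+ l) * β)    ≡⟨ convex-split α β k l ⟨
      + suc (k ℕ.+ l) * (α + + k * β)                  ∎)
    where open ℤ.≤-Reasoning

  affine-nonpos-between : ∀ {α β} k l → α ≤ 0ℤ → α + + suc (k ℕ.+ l) * β ≤ 0ℤ → α + + k * β ≤ 0ℤ
  affine-nonpos-between {α} {β} k l α≤0 αₙ≤0 = ℤ.neg-cancel-≤ (subst (0ℤ ≤_) (negate (+ k))
    (affine-nonneg-between k l (ℤ.neg-mono-≤ α≤0) (subst (0ℤ ≤_) (sym (negate (+ suc (k ℕ.+ l)))) (ℤ.neg-mono-≤ αₙ≤0))))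
    where
    identity : ∀ α β m → - α + m * - β ≡ - (α + m * β)
    identity = solve-∀
    negate : ∀ m → - α + m * - β ≡ - (α + m * β)
    negate = identity α β

  noncollinear-distinct : ∀ a b c → NonCollinear a b c → a ≢ b × a ≢ c × b ≢ c
  noncollinear-distinct a b c nc =
    (λ { refl → nc (orient-base a c) }) , (λ { refl → nc (orient-tail a b) }) , (λ { refl → nc (orient-head a b) })

  ZeroOr : ℤ → ℤ → Set
  ZeroOr Δ x = x ≡ 0ℤ ⊎ x ≡ Δ

  InTri-from-sides : ∀ a b c p → ZeroOr (orient a b c) (orient a b p) → ZeroOr (orient a b c) (orient b c p)
                     → ZeroOr (orient a b c) (orient c a p) → InTri a b c p
  InTri-from-sides a b c p x y z with ℤ.≤-total 0ℤ (orient a b c)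
  ... | inj₁ 0≤Δ = inj₁ (sign x , sign y , sign z)
    where
    sign : ∀ {s} → ZeroOr (orient a b c) s → 0ℤ ≤ s
    sign (inj₁ refl) = ℤ.≤-refl
    sign (inj₂ refl) = 0≤Δ
  ... | inj₂ Δ≤0 = inj₂ (sign x , sign y , sign z)
    where
    sign : ∀ {s} → ZeroOr (orient a b c) s → s ≤ 0ℤ
    sign (inj₁ refl) = ℤ.≤-refl
    sign (inj₂ refl) = Δ≤0

  vertices-InTri : ∀ a b c → InTri a b c a × InTri a b c b × InTri a b c c
  vertices-InTri a b c =
      InTri-from-sides a b c a (inj₁ (orient-tail a b)) (inj₂ (orient-rotate a b c)) (inj₁ (orient-head c a))
    , InTri-from-sides a b c b (inj₁ (orient-head a b)) (inj₁ (orient-tail b c)) (inj₂ (sym (orient-rotate c a b)))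
    , InTri-from-sides a b c c (inj₂ refl) (inj₁ (orient-head b c)) (inj₁ (orient-tail c a))

  InTri-opposite-signs : ∀ a b c p q →
    0ℤ ≤ orient a b p × 0ℤ ≤ orient b c p × 0ℤ ≤ orient c a p →
    orient a b q ≤ 0ℤ × orient b c q ≤ 0ℤ × orient c a q ≤ 0ℤ → orient a b c ≡ 0ℤ
  InTri-opposite-signs a b c p q (p₁ , p₂ , p₃) (q₁ , q₂ , q₃) = ℤ.≤-antisym
    (subst (_≤ 0ℤ) (orient-sum a b c q) (ℤ.+-mono-≤ (ℤ.+-mono-≤ q₁ q₂) q₃))
    (subst (0ℤ ≤_) (orient-sum a b c p) (ℤ.+-mono-≤ (ℤ.+-mono-≤ p₁ p₂) p₃))

  InTri-segment : ∀ {a b c} p u k l → NonCollinear a b c →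
    InTri a b c p → InTri a b c (p +ᵥ + suc (k ℕ.+ l) *ᵥ u) → InTri a b c (p +ᵥ + k *ᵥ u)
  InTri-segment {a} {b} {c} p u k l nc (inj₁ (p₁ , p₂ , p₃)) (inj₁ (q₁ , q₂ , q₃)) =
    inj₁ (nonneg a b p₁ q₁ , nonneg b c p₂ q₂ , nonneg c a p₃ q₃)
    where
    nonneg : ∀ x y → 0ℤ ≤ orient x y p → 0ℤ ≤ orient x y (p +ᵥ + suc (k ℕ.+ l) *ᵥ u) → 0ℤ ≤ orient x y (p +ᵥ + k *ᵥ u)
    nonneg x y h₀ hₙ rewrite orient-along x y p u (+ k) =
      affine-nonneg-between k l h₀ (subst (0ℤ ≤_) (orient-along x y p u (+ suc (k ℕ.+ l))) hₙ)
  InTri-segment {a} {b} {c} p u k l nc (inj₂ (p₁ , p₂ , p₃)) (inj₂ (q₁ , q₂ , q₃)) =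
    inj₂ (nonpos a b p₁ q₁ , nonpos b c p₂ q₂ , nonpos c a p₃ q₃)
    where
    nonpos : ∀ x y → orient x y p ≤ 0ℤ → orient x y (p +ᵥ + suc (k ℕ.+ l) *ᵥ u) ≤ 0ℤ → orient x y (p +ᵥ + k *ᵥ u) ≤ 0ℤ
    nonpos x y h₀ hₙ rewrite orient-along x y p u (+ k) =
      affine-nonpos-between k l h₀ (subst (_≤ 0ℤ) (orient-along x y p u (+ suc (k ℕ.+ l))) hₙ)
  InTri-segment {a} {b} {c} p u k l nc (inj₁ P) (inj₂ Q) =
    ⊥-elim (nc (InTri-opposite-signs a b c p (p +ᵥ + suc (k ℕ.+ l) *ᵥ u) P Q))
  InTri-segment {a} {b} {c} p u k l nc (inj₂ P) (inj₁ Q) =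
    ⊥-elim (nc (InTri-opposite-signs a b c (p +ᵥ + suc (k ℕ.+ l) *ᵥ u) p Q P))

  -- Minimal triangles and S₂/₉

  line-injective : ∀ p u {k m} → u ≢ (0ℤ , 0ℤ) → p +ᵥ k *ᵥ u ≡ p +ᵥ m *ᵥ u → k ≡ m
  line-injective (px , py) (ux , uy) {k} {m} u≢0 eq with ux ℤ.≟ 0ℤ | uy ℤ.≟ 0ℤ
  ... | no ux≢0   | _         = ℤ.*-cancelʳ-≡ k m ux {{ℤ.≢-nonZero ux≢0}} (∙-cancelˡ px _ _ (cong proj₁ eq))
  ... | yes _     | no uy≢0   = ℤ.*-cancelʳ-≡ k m uy {{ℤ.≢-nonZero uy≢0}} (∙-cancelˡ py _ _ (cong proj₂ eq))
  ... | yes refl  | yes refl  = ⊥-elim (u≢0 refl)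

  line-points : Pt → Pt → ℕ → List Pt
  line-points p u = applyUpTo (λ k → p +ᵥ + k *ᵥ u)

  line-points-unique : ∀ p u n → u ≢ (0ℤ , 0ℤ) → Unique (line-points p u n)
  line-points-unique p u n u≢0 = applyUpTo⁺₁ _ n λ s<t _ eq → ℕ.<⇒≢ s<t (ℤ.+-injective (line-injective p u u≢0 eq))

  ∈-line-points⁻ : ∀ p u {n q} → q ∈ line-points p u n → ∃[ k ] q ≡ p +ᵥ + k *ᵥ u
  ∈-line-points⁻ p u q∈ with k , _ , refl ← ∈-applyUpTo⁻ _ q∈ = k , refl

  corners : Pt → Pt → Pt → Pt → List Pt
  corners a b c d = a ∷ b ∷ c ∷ d ∷ []

  MinimalTri⇒∈corners : ∀ {a b c d p} → MinimalTri a b c d → InTri a b c p → p ∈ corners a b c d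
  MinimalTri⇒∈corners {p = p} (_ , _ , _ , _ , _ , only) p∈T with only p p∈T
  ... | inj₁ p≡a                = here p≡a
  ... | inj₂ (inj₁ p≡b)         = there (here p≡b)
  ... | inj₂ (inj₂ (inj₁ p≡c))  = there (there (here p≡c))
  ... | inj₂ (inj₂ (inj₂ p≡d))  = there (there (there (here p≡d)))

  ThreeStep : Pt → Pt → Set
  ThreeStep p q = ∃[ u ] q ≡ p +ᵥ + 3 *ᵥ u

  MinimalTri-no-ThreeStep : ∀ {a b c d x y} → MinimalTri a b c d →
                            InTri a b c x → InTri a b c y → x ≢ y → ¬ ThreeStep x y
  MinimalTri-no-ThreeStep {a} {b} {c} {d} {x} T@(nc , _) x∈T y∈T x≢y (u , refl) = nc collinear
    where
    u≢0 : u ≢ (0ℤ , 0ℤ)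
    u≢0 refl = x≢y (sym (cong₂ _,_ (ℤ.+-identityʳ _) (ℤ.+-identityʳ _)))
    segment⊆T : ∀ {q} → q ∈ line-points x u 4 → InTri a b c q
    segment⊆T (here refl)                         = InTri-segment {a} {b} {c} x u 0 2 nc x∈T y∈T
    segment⊆T (there (here refl))                 = InTri-segment {a} {b} {c} x u 1 1 nc x∈T y∈T
    segment⊆T (there (there (here refl)))         = InTri-segment {a} {b} {c} x u 2 0 nc x∈T y∈T
    segment⊆T (there (there (there (here refl)))) = y∈T
    corners⊆segment : corners a b c d ⊆ line-points x u 4
    corners⊆segment = Unique-⊆-length-≥⇒⊇ _≟ₚ_ (line-points-unique x u 4 u≢0)
                        (MinimalTri⇒∈corners T ∘ segment⊆T) ℕ.≤-refl
    collinear : orient a b c ≡ 0ℤ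
    collinear with k , refl ← ∈-line-points⁻ x u (corners⊆segment (here refl))
                 | l , refl ← ∈-line-points⁻ x u (corners⊆segment (there (here refl)))
                 | m , refl ← ∈-line-points⁻ x u (corners⊆segment (there (there (here refl))))
                 = orient-collinear x u (+ k) (+ l) (+ m)

  offset : Bool → ℤ
  offset false = 0ℤ
  offset true  = + 1

  cell : ℤ → ℤ → Bool → Pt
  cell i j r = + 3 * i + offset r , + 3 * j

  S29⇒cell : ∀ {p} → S29 p → ∃[ i ] ∃[ j ] ∃[ r ] p ≡ cell i j r
  S29⇒cell (i , j , inj₁ refl , refl) = i , j , false , cong (_, _) (sym (ℤ.+-identityʳ _))
  S29⇒cell (i , j , inj₂ refl , refl) = i , j , true , refl

  cell-S29 : ∀ i j r → S29 (cell i j r)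
  cell-S29 i j false = i , j , inj₁ (ℤ.+-identityʳ _) , refl
  cell-S29 i j true  = i , j , inj₂ refl , refl

  cell-ThreeStep : ∀ i j i' j' r → ThreeStep (cell i j r) (cell i' j' r)
  cell-ThreeStep i j i' j' r = (i' - i , j' - j) , cong₂ _,_ (shift-x i i' (offset r)) (shift-y j j')
    where
    shift-x : ∀ i i' e → + 3 * i' + e ≡ + 3 * i + e + + 3 * (i' - i)
    shift-x = solve-∀
    shift-y : ∀ j j' → + 3 * j' ≡ + 3 * j + + 3 * (j' - j)
    shift-y = solve-∀

  S29-pigeonhole : ∀ {x y z} → S29 x → S29 y → S29 z → ThreeStep x y ⊎ ThreeStep x z ⊎ ThreeStep y z
  S29-pigeonhole sx sy sz with S29⇒cell sx | S29⇒cell sy | S29⇒cell sz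
  ... | i , j , r , refl | i' , j' , r' , refl | i'' , j'' , r'' , refl = by-residue r r' r''
    where
    by-residue : ∀ r r' r'' → ThreeStep (cell i j r) (cell i' j' r') ⊎ ThreeStep (cell i j r) (cell i'' j'' r'')
                                  ⊎ ThreeStep (cell i' j' r') (cell i'' j'' r'')
    by-residue false false _     = inj₁ (cell-ThreeStep i j i' j' false)
    by-residue true  true  _     = inj₁ (cell-ThreeStep i j i' j' true)
    by-residue false true  false = inj₂ (inj₁ (cell-ThreeStep i j i'' j'' false))
    by-residue true  false true  = inj₂ (inj₁ (cell-ThreeStep i j i'' j'' true))
    by-residue false true  true  = inj₂ (inj₂ (cell-ThreeStep i' j' i'' j'' true))
    by-residue true  false false = inj₂ (inj₂ (cell-ThreeStep i' j' i'' j'' false))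

  MinimalTri⇒¬ExactlyThree-S29 : ∀ {a b c d} → MinimalTri a b c d → ¬ ExactlyThree S29 a b c d
  MinimalTri⇒¬ExactlyThree-S29 {a} {b} {c} {d} T@(nc , d≢a , d≢b , d≢c , d∈T , _) = no-three
    where
    a≢b = proj₁ (noncollinear-distinct a b c nc)
    a≢c = proj₁ (proj₂ (noncollinear-distinct a b c nc))
    b≢c = proj₂ (proj₂ (noncollinear-distinct a b c nc))
    a∈T = proj₁ (vertices-InTri a b c)
    b∈T = proj₁ (proj₂ (vertices-InTri a b c))
    c∈T = proj₂ (proj₂ (vertices-InTri a b c))

    at-most-two : ∀ {x y z} → InTri a b c x → InTri a b c y → InTri a b c z →
                  x ≢ y → x ≢ z → y ≢ z → S29 x → S29 y → S29 z → ⊥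
    at-most-two x∈T y∈T z∈T x≢y x≢z y≢z sx sy sz with S29-pigeonhole sx sy sz
    ... | inj₁ x→y        = MinimalTri-no-ThreeStep T x∈T y∈T x≢y x→y
    ... | inj₂ (inj₁ x→z) = MinimalTri-no-ThreeStep T x∈T z∈T x≢z x→z
    ... | inj₂ (inj₂ y→z) = MinimalTri-no-ThreeStep T y∈T z∈T y≢z y→z

    no-three : ¬ ExactlyThree S29 a b c d
    no-three (inj₁ (_ , sb , sc , sd))               = at-most-two b∈T c∈T d∈T b≢c (≢-sym d≢b) (≢-sym d≢c) sb sc sd
    no-three (inj₂ (inj₁ (sa , _ , sc , sd)))        = at-most-two a∈T c∈T d∈T a≢c (≢-sym d≢a) (≢-sym d≢c) sa sc sd
    no-three (inj₂ (inj₂ (inj₁ (sa , sb , _ , sd)))) = at-most-two a∈T b∈T d∈T a≢b (≢-sym d≢a) (≢-sym d≢b) sa sb sd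
    no-three (inj₂ (inj₂ (inj₂ (sa , sb , sc , _)))) = at-most-two a∈T b∈T c∈T a≢b a≢c b≢c sa sb sc

  S29-BIStable : BIStable S29
  S29-BIStable = (λ a b c d border → MinimalTri⇒¬ExactlyThree-S29 (proj₁ border))
               , (λ a b c d internal → MinimalTri⇒¬ExactlyThree-S29 (proj₁ internal))

  -- Counting S₂/₉ in boxes

  floor-nonneg : ∀ x s → s ≤ + 2 → 0ℤ ≤ + 3 * x + s → 0ℤ ≤ x
  floor-nonneg x s s≤2 0≤3x+s = ℤ.i<j⇒suc[i]≤j (ℤ.*-cancelˡ-<-nonNeg { -1ℤ} {x} (+ 3) (begin-strict
    + 3 * -1ℤ                  <⟨ -<- ℕ.≤-refl ⟩
    -[1+ 1 ]                   ≤⟨ ℤ.+-monoˡ-≤ (- + 2) (ℤ.≤-trans 0≤3x+s (ℤ.+-monoʳ-≤ (+ 3 * x) s≤2)) ⟩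
    + 3 * x + + 2 - + 2        ≡⟨ identity x ⟩
    + 3 * x                    ∎))
    where
    open ℤ.≤-Reasoning
    identity : ∀ x → + 3 * x + + 2 - + 2 ≡ + 3 * x
    identity = solve-∀

  InInterval : ℕ → ℤ → Set
  InInterval n x = - + n ≤ x × x ≤ + n

  InInterval⇒margins : ∀ {n x} → InInterval n x → 0ℤ ≤ x + + n × 0ℤ ≤ + n - x
  InInterval⇒margins {n} {x} (lo , hi) =
    subst (0ℤ ≤_) (cong (λ t → x + t) (ℤ.neg-involutive (+ n))) (ℤ.i≤j⇒0≤j-i lo) , ℤ.i≤j⇒0≤j-i hi

  margins⇒InInterval : ∀ {n x} → 0ℤ ≤ x + + n → 0ℤ ≤ + n - x → InInterval n x
  margins⇒InInterval {n} {x} lo hi =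
    ℤ.0≤i-j⇒j≤i (subst (0ℤ ≤_) (cong (λ t → x + t) (sym (ℤ.neg-involutive (+ n)))) lo) , ℤ.0≤i-j⇒j≤i hi

  radius-3k+1 : ∀ k → + (3 ℕ.* k ℕ.+ 1) ≡ + 3 * + k + + 1
  radius-3k+1 k = trans (ℤ.pos-+ (3 ℕ.* k) 1) (cong (λ t → t + + 1) (ℤ.pos-* 3 k))

  lower-margin : ∀ k i e → + 3 * i + e + + (3 ℕ.* k ℕ.+ 1) ≡ + 3 * (i + + k) + (e + + 1)
  lower-margin k i e rewrite radius-3k+1 k = identity i (+ k) e
    where
    identity : ∀ i k e → + 3 * i + e + (+ 3 * k + + 1) ≡ + 3 * (i + k) + (e + + 1)
    identity = solve-∀

  upper-margin : ∀ k i e → + (3 ℕ.* k ℕ.+ 1) - (+ 3 * i + e) ≡ + 3 * (+ k - i) + (+ 1 - e)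
  upper-margin k i e rewrite radius-3k+1 k = identity i (+ k) e
    where
    identity : ∀ i k e → + 3 * k + + 1 - (+ 3 * i + e) ≡ + 3 * (k - i) + (+ 1 - e)
    identity = solve-∀

  offset-margins : ∀ r → (0ℤ ≤ offset r + + 1 × offset r + + 1 ≤ + 2) × (0ℤ ≤ + 1 - offset r × + 1 - offset r ≤ + 2)
  offset-margins false = (+≤+ z≤n , +≤+ (s≤s z≤n)) , (+≤+ z≤n , +≤+ (s≤s z≤n))
  offset-margins true  = (+≤+ z≤n , +≤+ (s≤s (s≤s z≤n))) , (+≤+ z≤n , +≤+ z≤n)

  scale-InInterval⁻ : ∀ k i r → InInterval (3 ℕ.* k ℕ.+ 1) (+ 3 * i + offset r) → InInterval k i
  scale-InInterval⁻ k i r box with lo , hi ← InInterval⇒margins box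
                                | (_ , e+1≤2) , (_ , 1-e≤2) ← offset-margins r =
    margins⇒InInterval
      (floor-nonneg (i + + k) (offset r + + 1) e+1≤2 (subst (0ℤ ≤_) (lower-margin k i (offset r)) lo))
      (floor-nonneg (+ k - i) (+ 1 - offset r) 1-e≤2 (subst (0ℤ ≤_) (upper-margin k i (offset r)) hi))

  scale-InInterval⁺ : ∀ k i r → InInterval k i → InInterval (3 ℕ.* k ℕ.+ 1) (+ 3 * i + offset r)
  scale-InInterval⁺ k i r box with lo , hi ← InInterval⇒margins box
                                | (0≤e+1 , _) , (0≤1-e , _) ← offset-margins r =
    margins⇒InInterval
      (subst (0ℤ ≤_) (sym (lower-margin k i (offset r))) (ℤ.+-mono-≤ (scaled-nonneg 3 lo) 0≤e+1))
      (subst (0ℤ ≤_) (sym (upper-margin k i (offset r))) (ℤ.+-mono-≤ (scaled-nonneg 3 hi) 0≤1-e))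

  interval-point : ℕ → ℕ → ℤ
  interval-point k t = + t - + k

  interval : ℕ → List ℤ
  interval k = applyUpTo (interval-point k) (suc (k ℕ.+ k))

  interval-unique : ∀ k → Unique (interval k)
  interval-unique k = applyUpTo⁺₁ (interval-point k) _ λ s<t _ eq → ℕ.<⇒≢ s<t (ℤ.+-injective (∙-cancelʳ (- + k) _ _ eq))

  length-interval : ∀ k → length (interval k) ≡ suc (k ℕ.+ k)
  length-interval k = length-applyUpTo (interval-point k) _

  ∈-interval⁻ : ∀ {k i} → i ∈ interval k → InInterval k i
  ∈-interval⁻ {k} i∈ with t , t<2k+1 , refl ← ∈-applyUpTo⁻ (interval-point k) i∈ =
    margins⇒InInterval (subst (0ℤ ≤_) (sym (cancel (+ t) (+ k))) (+≤+ z≤n))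
                       (subst (0ℤ ≤_) (sym (shift (+ t) (+ k))) (ℤ.i≤j⇒0≤j-i (subst (+ t ≤_) (ℤ.pos-+ k k) (+≤+ (ℕ.≤-pred t<2k+1)))))
    where
    cancel : ∀ t k → t - k + k ≡ t
    cancel = solve-∀
    shift : ∀ t k → k - (t - k) ≡ (k + k) - t
    shift = solve-∀

  ∈-interval⁺ : ∀ {k i} → InInterval k i → i ∈ interval k
  ∈-interval⁺ {k} {i} box with lo , hi ← InInterval⇒margins box =
    subst (_∈ interval k) (trans (cong (_- + k) (ℤ.0≤i⇒+∣i∣≡i lo)) (cancel i (+ k)))
          (∈-applyUpTo⁺ (interval-point k) (s≤s (ℤ.drop‿+≤+ t≤2k)))
    where
    cancel : ∀ i k → i + k - k ≡ i
    cancel = solve-∀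
    t≤2k : + ℤ.∣ i + + k ∣ ≤ + (k ℕ.+ k)
    t≤2k = subst₂ _≤_ (sym (ℤ.0≤i⇒+∣i∣≡i lo)) (sym (ℤ.pos-+ k k)) (ℤ.+-monoˡ-≤ (+ k) (proj₂ box))

  residues : List Bool
  residues = false ∷ true ∷ []

  ∈-residues : ∀ r → r ∈ residues
  ∈-residues false = here refl
  ∈-residues true = there (here refl)

  residues-unique : Unique residues
  residues-unique = ((λ ()) All.∷ All.[]) ∷ All.[] ∷ []

  three∤one : ∀ t → + 3 * t ≢ + 1
  three∤one (+ 0) ()
  three∤one +[1+ n ] eq with () ← ℕ.m+n≡0⇒n≡0 n (ℕ.suc-injective (ℤ.+-injective eq))
  three∤one -[1+ n ] ()

  residues-disjoint : ∀ i i' → + 3 * i + 0ℤ ≢ + 3 * i' + + 1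
  residues-disjoint i i' eq = three∤one (i - i') (begin
    + 3 * (i - i')                  ≡⟨ identity₀ i i' ⟩
    + 3 * i + 0ℤ - + 3 * i'         ≡⟨ cong (_- + 3 * i') eq ⟩
    + 3 * i' + + 1 - + 3 * i'       ≡⟨ identity₁ i' ⟩
    + 1                             ∎)
    where
    open ≡-Reasoning
    identity₀ : ∀ i i' → + 3 * (i - i') ≡ + 3 * i + 0ℤ - + 3 * i'
    identity₀ = solve-∀
    identity₁ : ∀ i' → + 3 * i' + + 1 - + 3 * i' ≡ + 1
    identity₁ = solve-∀

  residue-injective : ∀ i i' r r' → + 3 * i + offset r ≡ + 3 * i' + offset r' → i ≡ i' × r ≡ r'
  residue-injective i i' false false eq = ℤ.*-cancelˡ-≡ (+ 3) i i' (∙-cancelʳ 0ℤ _ _ eq) , refl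
  residue-injective i i' true  true  eq = ℤ.*-cancelˡ-≡ (+ 3) i i' (∙-cancelʳ (+ 1) _ _ eq) , refl
  residue-injective i i' false true  eq = ⊥-elim (residues-disjoint i i' eq)
  residue-injective i i' true  false eq = ⊥-elim (residues-disjoint i' i (sym eq))

  cell-injective : ∀ {i i' j j' r r'} → cell i j r ≡ cell i' j' r' → i ≡ i' × j ≡ j' × r ≡ r'
  cell-injective {i} {i'} {j} {j'} {r} {r'} eq with residue-injective i i' r r' (cong proj₁ eq)
  ... | i≡i' , r≡r' = i≡i' , ℤ.*-cancelˡ-≡ (+ 3) j j' (cong proj₂ eq) , r≡r'

  cell-InBox⁺ : ∀ k i j r → InInterval k i → InInterval k j → InBox (3 ℕ.* k ℕ.+ 1) (cell i j r)
  cell-InBox⁺ k i j r i∈ j∈ =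
    scale-InInterval⁺ k i r i∈ , subst (InInterval _) (ℤ.+-identityʳ _) (scale-InInterval⁺ k j false j∈)

  cell-InBox⁻ : ∀ k i j r → InBox (3 ℕ.* k ℕ.+ 1) (cell i j r) → InInterval k i × InInterval k j
  cell-InBox⁻ k i j r (i∈ , j∈) =
    scale-InInterval⁻ k i r i∈ , scale-InInterval⁻ k j false (subst (InInterval _) (sym (ℤ.+-identityʳ _)) j∈)

  place : ℤ → ℤ × Bool → Pt
  place i (j , r) = cell i j r

  grid : ℕ → List Pt
  grid k = cartesianProductWith place (interval k) (cartesianProduct (interval k) residues)

  grid-unique : ∀ k → Unique (grid k)
  grid-unique k = cartesianProductWith⁺ place injective (interval-unique k) (cartesianProduct⁺ (interval-unique k) residues-unique)
    where
    injective : ∀ {i i' jr jr'} → place i jr ≡ place i' jr' → i ≡ i' × jr ≡ jr'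
    injective {i} {i'} {j , r} {j' , r'} eq with i≡i' , refl , refl ← cell-injective {i} {i'} {j} {j'} {r} {r'} eq =
      i≡i' , refl

  length-grid : ∀ k → length (grid k) ≡ suc (k ℕ.+ k) ℕ.* (suc (k ℕ.+ k) ℕ.* 2)
  length-grid k = begin
    length (grid k)                                                    ≡⟨ length-cartesianProductWith place (interval k) (cartesianProduct (interval k) residues) ⟩
    length (interval k) ℕ.* length (cartesianProduct (interval k) residues)
      ≡⟨ cong (length (interval k) ℕ.*_) (length-cartesianProductWith _,_ (interval k) residues) ⟩
    length (interval k) ℕ.* (length (interval k) ℕ.* 2)                ≡⟨ cong (λ m → m ℕ.* (m ℕ.* 2)) (length-interval k) ⟩
    suc (k ℕ.+ k) ℕ.* (suc (k ℕ.+ k) ℕ.* 2)                            ∎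
    where open ≡-Reasoning

  ∈-grid⁻ : ∀ {k p} → p ∈ grid k → InBox (3 ℕ.* k ℕ.+ 1) p × S29 p
  ∈-grid⁻ {k} p∈ with i , (j , r) , i∈ , jr∈ , refl ← ∈-cartesianProductWith⁻ place (interval k) _ p∈ =
    cell-InBox⁺ k i j r (∈-interval⁻ i∈) (∈-interval⁻ (proj₁ (∈-cartesianProduct⁻ (interval k) residues jr∈))) , cell-S29 i j r

  ∈-grid⁺ : ∀ {k p} → InBox (3 ℕ.* k ℕ.+ 1) p → S29 p → p ∈ grid k
  ∈-grid⁺ {k} p∈box sp with i , j , r , refl ← S29⇒cell sp =
    let i∈ , j∈ = cell-InBox⁻ k i j r p∈box in
    ∈-cartesianProductWith⁺ place (∈-interval⁺ i∈) (∈-cartesianProduct⁺ (∈-interval⁺ j∈) (∈-residues r))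

module _ where

  open import Data.Nat using (_+_; _*_; _≤_; _<_)
  open import Data.Nat.Properties using (≤-trans; *-monoˡ-≤; *-monoʳ-≤; *-mono-≤; +-monoˡ-≤; +-monoʳ-≤; m≤m+n; m≤n*m)
  open import Data.Nat.Tactic.RingSolver using (solve-∀)
  open import Data.Nat.Coprimality using (Coprime)
  open import Data.Rational as ℚ using (mkℚ; 0ℚ)
  import Data.Rational.Properties as ℚ
  open import Data.Rational.Unnormalised as ℚᵘ using (mkℚᵘ)
  import Data.Rational.Unnormalised.Properties as ℚᵘ

  -- Density

  InBox-mono : ∀ {m n p} → m ≤ n → InBox m p → InBox n p
  InBox-mono m≤n ((x₁ , x₂) , (y₁ , y₂)) =
    (ℤ.≤-trans (ℤ.neg-mono-≤ (+≤+ m≤n)) x₁ , ℤ.≤-trans x₂ (+≤+ m≤n)) ,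
    (ℤ.≤-trans (ℤ.neg-mono-≤ (+≤+ m≤n)) y₁ , ℤ.≤-trans y₂ (+≤+ m≤n))

  S29-count : ∀ k → CountIs S29 (3 * k + 1) (length (grid k))
  S29-count k = grid k , grid-unique k , refl , λ p → ∈-grid⁻ {k} , λ (p∈box , sp) → ∈-grid⁺ {k} p∈box sp

  count-≤-grid : ∀ {n N} k → n ≤ 3 * k + 1 → CountIs S29 n N → N ≤ length (grid k)
  count-≤-grid k n≤ (L , unique , refl , mem) =
    Unique-⊆⇒length-≤ _≟ₚ_ unique λ {p} p∈L → let p∈box , sp = proj₁ (mem p) p∈L in ∈-grid⁺ {k} (InBox-mono n≤ p∈box) sp

  covering-radius : ∀ n → ∃[ k ] n ≤ 3 * k + 1 × 3 * k ≤ n + 2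
  covering-radius 0 = 0 , z≤n , z≤n
  covering-radius 1 = 0 , s≤s z≤n , z≤n
  covering-radius 2 = 1 , s≤s (s≤s z≤n) , s≤s (s≤s (s≤s z≤n))
  covering-radius (suc (suc (suc n))) with k , n≤ , ≤n+2 ← covering-radius n =
    suc k , subst (3 + n ≤_) (sym (step k)) (+-monoʳ-≤ 3 n≤) , subst (_≤ 3 + (n + 2)) (sym (ℕ.*-suc 3 k)) (+-monoʳ-≤ 3 ≤n+2)
    where
    step : ∀ k → 3 * suc k + 1 ≡ 3 + (3 * k + 1)
    step = solve-∀

  grid-size : ∀ k → 9 * length (grid k) ≡ 2 * ((6 * k + 3) * (6 * k + 3))
  grid-size k = trans (cong (9 *_) (length-grid k)) (identity k)
    where
    identity : ∀ k → 9 * (suc (k + k) * (suc (k + k) * 2)) ≡ 2 * ((6 * k + 3) * (6 * k + 3))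
    identity = solve-∀

  tail-bound : ∀ {n} Q → 6 * Q ≤ n → 2 * Q * ((2 * n + 7) * (2 * n + 7)) < (2 * Q + 9) * suc (4 * n * n + 4 * n)
  tail-bound {n} Q 6Q≤n = begin-strict
    2 * Q * ((2 * n + 7) * (2 * n + 7))      ≡⟨ expand-square Q n ⟩
    2 * Q * D + 6 * Q * (8 * n + 16)         ≤⟨ ℕ.+-monoʳ-≤ (2 * Q * D) (*-monoˡ-≤ (8 * n + 16) 6Q≤n) ⟩
    2 * Q * D + n * (8 * n + 16)             <⟨ ℕ.+-monoʳ-< (2 * Q * D) (subst (n * (8 * n + 16) <_) (sym (nine-square n)) (ℕ.m<m+n _ (s≤s z≤n))) ⟩
    2 * Q * D + 9 * D                        ≡⟨ factor Q D ⟩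
    (2 * Q + 9) * D                          ∎
    where
    open ℕ.≤-Reasoning
    D = suc (4 * n * n + 4 * n)
    expand-square : ∀ Q n → 2 * Q * ((2 * n + 7) * (2 * n + 7)) ≡ 2 * Q * suc (4 * n * n + 4 * n) + 6 * Q * (8 * n + 16)
    expand-square = solve-∀
    nine-square : ∀ n → 9 * suc (4 * n * n + 4 * n) ≡ n * (8 * n + 16) + suc (28 * n * n + 20 * n + 8)
    nine-square = solve-∀
    factor : ∀ Q D → 2 * Q * D + 9 * D ≡ (2 * Q + 9) * D
    factor = solve-∀

  -- The cross-multiplied form of  ratio n N < 2/9 + (P + 1)/Q.
  count-bound : ∀ {n N} P Q → 6 * Q ≤ n → CountIs S29 n N →
                N * (9 * Q) < (2 * Q + suc P * 9) * suc (4 * n * n + 4 * n)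
  count-bound {n} {N} P Q 6Q≤n count with k , n≤3k+1 , 3k≤n+2 ← covering-radius n = begin-strict
    N * (9 * Q)                                ≡⟨ reorder N Q ⟩
    9 * N * Q                                  ≤⟨ *-monoˡ-≤ Q (*-monoʳ-≤ 9 (count-≤-grid k n≤3k+1 count)) ⟩
    9 * length (grid k) * Q                    ≡⟨ cong (_* Q) (grid-size k) ⟩
    2 * ((6 * k + 3) * (6 * k + 3)) * Q        ≤⟨ *-monoˡ-≤ Q (*-monoʳ-≤ 2 (*-mono-≤ side side)) ⟩
    2 * ((2 * n + 7) * (2 * n + 7)) * Q        ≡⟨ swap Q _ ⟩
    2 * Q * ((2 * n + 7) * (2 * n + 7))        <⟨ tail-bound Q 6Q≤n ⟩
    (2 * Q + 9) * D                            ≤⟨ *-monoˡ-≤ D (ℕ.+-monoʳ-≤ (2 * Q) (m≤n*m 9 (suc P))) ⟩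
    (2 * Q + suc P * 9) * D                    ∎
    where
    open ℕ.≤-Reasoning
    D = suc (4 * n * n + 4 * n)
    side : 6 * k + 3 ≤ 2 * n + 7
    side = subst₂ _≤_ (double k) (double-n n) (+-monoˡ-≤ 3 (*-monoʳ-≤ 2 3k≤n+2))
      where
      double : ∀ k → 2 * (3 * k) + 3 ≡ 6 * k + 3
      double = solve-∀
      double-n : ∀ n → 2 * (n + 2) + 3 ≡ 2 * n + 7
      double-n = solve-∀
    reorder : ∀ N Q → N * (9 * Q) ≡ 9 * N * Q
    reorder = solve-∀
    swap : ∀ Q S → 2 * S * Q ≡ 2 * Q * S
    swap = solve-∀

  ratio-exact : ∀ k → ratio (3 * k + 1) (length (grid k)) ≡ + 2 / 9
  ratio-exact k = ℚ.fromℚᵘ-cong {mkℚᵘ (+ N) D} {mkℚᵘ (+ 2) 8} (ℚᵘ.*≡* (begin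
    + N ℤ.* + 9           ≡⟨ ℤ.pos-* N 9 ⟨
    + (N * 9)             ≡⟨ cong +_ (trans (ℕ.*-comm N 9) (trans (grid-size k) (square k))) ⟩
    + (2 * suc D)         ≡⟨ ℤ.pos-* 2 (suc D) ⟩
    + 2 ℤ.* + suc D       ∎))
    where
    open ≡-Reasoning
    N = length (grid k)
    D = 4 * (3 * k + 1) * (3 * k + 1) + 4 * (3 * k + 1)
    square : ∀ k → 2 * ((6 * k + 3) * (6 * k + 3)) ≡ 2 * suc (4 * (3 * k + 1) * (3 * k + 1) + 4 * (3 * k + 1))
    square = solve-∀

  ratio-<-2/9+ : ∀ {n N P q} .{c : Coprime (suc P) (suc q)} →
                 N * (9 * suc q) < (2 * suc q + suc P * 9) * suc (4 * n * n + 4 * n) →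
                 ratio n N ℚ.< + 2 / 9 ℚ.+ mkℚ (+ suc P) q c
  ratio-<-2/9+ {n} {N} {P} {q} {c} lt = ℚ.toℚᵘ-cancel-< (ℚᵘ.<-respʳ-≃ sum≃ (ℚᵘ.<-respˡ-≃ ratio≃ core))
    where
    D = 4 * n * n + 4 * n
    core : mkℚᵘ (+ N) D ℚᵘ.< mkℚᵘ (+ 2) 8 ℚᵘ.+ mkℚᵘ (+ suc P) q
    core = ℚᵘ.*<* (subst₂ ℤ._<_ (ℤ.pos-* N (9 * suc q)) numerator (ℤ.+<+ lt))
      where
      numerator : + ((2 * suc q + suc P * 9) * suc D) ≡ (+ 2 ℤ.* + suc q ℤ.+ + suc P ℤ.* + 9) ℤ.* + suc D
      numerator = trans (ℤ.pos-* (2 * suc q + suc P * 9) (suc D)) (cong (ℤ._* + suc D)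
        (trans (ℤ.pos-+ (2 * suc q) (suc P * 9)) (cong₂ ℤ._+_ (ℤ.pos-* 2 (suc q)) (ℤ.pos-* (suc P) 9))))
    ratio≃ : mkℚᵘ (+ N) D ℚᵘ.≃ ℚ.toℚᵘ (ratio n N)
    ratio≃ = ℚᵘ.≃-sym (ℚ.toℚᵘ-fromℚᵘ (mkℚᵘ (+ N) D))
    sum≃ : mkℚᵘ (+ 2) 8 ℚᵘ.+ mkℚᵘ (+ suc P) q ℚᵘ.≃ ℚ.toℚᵘ (+ 2 / 9 ℚ.+ mkℚ (+ suc P) q c)
    sum≃ = ℚᵘ.≃-sym (ℚᵘ.≃-trans (ℚ.toℚᵘ-homo-+ (+ 2 / 9) (mkℚ (+ suc P) q c))
                                (ℚᵘ.+-cong (ℚ.toℚᵘ-fromℚᵘ (mkℚᵘ (+ 2) 8)) (ℚᵘ.≃-refl {mkℚᵘ (+ suc P) q})))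

  S29-upper-density : ∀ ε → 0ℚ ℚ.< ε → Σ ℕ λ n₀ → ∀ n → n₀ ≤ n → ∀ N → CountIs S29 n N → ratio n N ℚ.< + 2 / 9 ℚ.+ ε
  S29-upper-density (mkℚ (+ 0) q c) (ℚ.*<* (ℤ.+<+ ()))
  S29-upper-density (mkℚ -[1+ P ] q c) (ℚ.*<* ())
  S29-upper-density (mkℚ (+ suc P) q c) _ =
    6 * suc q , λ n n₀≤n N count → ratio-<-2/9+ {n} {N} {P} {q} {c} (count-bound P (suc q) n₀≤n count)

  p-q<p : ∀ p {q} → 0ℚ ℚ.< q → p ℚ.- q ℚ.< p
  p-q<p p q>0 = subst (p ℚ.- _ ℚ.<_) (ℚ.+-identityʳ p) (ℚ.+-monoʳ-< p (ℚ.neg-antimono-< q>0))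

  S29-lower-density : ∀ ε → 0ℚ ℚ.< ε → ∀ n₀ → Σ ℕ λ n → n₀ ≤ n × Σ ℕ λ N → CountIs S29 n N × + 2 / 9 ℚ.- ε ℚ.< ratio n N
  S29-lower-density ε ε>0 n₀ =
    3 * n₀ + 1 , ≤-trans (m≤n*m n₀ 3) (m≤m+n (3 * n₀) 1) , length (grid n₀) , S29-count n₀ ,
    subst (+ 2 / 9 ℚ.- ε ℚ.<_) (sym (ratio-exact n₀)) (p-q<p (+ 2 / 9) ε>0)

proposition2p4 : BIStable S29 × UpperDensityIs S29 (+ 2 / 9)
proposition2p4 = S29-BIStable , S29-upper-density , S29-lower-density
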